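{- Let $\beta:F_2\to B_3$ be the homomorphism with $\beta(a)=\sigma_1$, $\beta(b)=\sigma_2^{ -1}$, and let $N$ be the subgroup of $B_3$ generated by $\sigma_1\sigma_2^{ -1}\sigma_1^{ -1}$. Then $\mathrm{Pal}^{ -1}(1)=\{w\in F_2\mid\mathrm{Pal}(w)=1\}$ equals $\beta^{ -1}(N)$.
   Context: $F_2$ is the free group on $a,b$. $B_3=\langle\sigma_1,\sigma_2\mid\sigma_1\sigma_2\sigma_1=\sigma_2\sigma_1\sigma_2\rangle$ is the braid group on three strands. $w\mapsto R_w$ is the group homomorphism $F_2\to\mathrm{Aut}(F_2)$ with $R_a(a)=a$, $R_a(b)=ba$, $R_b(a)=ab$, $R_b(b)=b$. The palindromization map $\mathrm{Pal}:F_2\to F_2$ is defined by $\mathrm{Pal}(w)=b^{ -1}a^{ -1}R_w(ab)$. -}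

module Defs where

open import Data.List using (List; []; _∷_; _++_; reverse; map; concatMap; replicate)
open import Data.List.Membership.Propositional using (_∈_)
open import Data.Nat using (ℕ)
open import Data.Integer using (ℤ; +_; -[1+_])
open import Data.Product using (∃)

-- Groups given by presentations: words in generators and their inverses,
-- modulo the congruence generated by free cancellation and relators.

data Letter (G : Set) : Set where
  pos : G → Letter G
  neg : G → Letter G

Word : Set → Set
Word G = List (Letter G)

invL : ∀ {G} → Letter G → Letter G
invL (pos x) = neg x
invL (neg x) = pos x

invW : ∀ {G} → Word G → Word G
invW w = reverse (map invL w)

-- Equality in the group ⟨ G | R ⟩ (the normal closure of R is generated
-- by inserting/deleting relators anywhere, together with free cancellation).
data Eq⟨_⟩ {G : Set} (R : List (Word G)) : Word G → Word G → Set where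
  ≈refl  : ∀ {u} → Eq⟨ R ⟩ u u
  ≈sym   : ∀ {u v} → Eq⟨ R ⟩ u v → Eq⟨ R ⟩ v u
  ≈trans : ∀ {u v w} → Eq⟨ R ⟩ u v → Eq⟨ R ⟩ v w → Eq⟨ R ⟩ u w
  ≈free  : ∀ u v x → Eq⟨ R ⟩ (u ++ x ∷ invL x ∷ v) (u ++ v)
  ≈rel   : ∀ u v r → r ∈ R → Eq⟨ R ⟩ (u ++ r ++ v) (u ++ v)

powW : ∀ {G} → Word G → ℤ → Word G
powW w (+ n)    = concatMapN n w
  where
  concatMapN : ℕ → Word _ → Word _
  concatMapN ℕ.zero    _ = []
  concatMapN (ℕ.suc k) u = u ++ concatMapN k u
powW w -[1+ n ] = powW (invW w) (+ (ℕ.suc n))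

data AB : Set where
  a b : AB

F₂ : Set
F₂ = Word AB

_≈F_ : F₂ → F₂ → Set
_≈F_ = Eq⟨ [] ⟩

data Σgen : Set where
  σ₁ σ₂ : Σgen

B₃ : Set
B₃ = Word Σgen

braidRelator : Word Σgen
braidRelator = pos σ₁ ∷ pos σ₂ ∷ pos σ₁ ∷ neg σ₂ ∷ neg σ₁ ∷ neg σ₂ ∷ []

_≈B_ : B₃ → B₃ → Set
_≈B_ = Eq⟨ braidRelator ∷ [] ⟩

substW : (AB → F₂) → F₂ → F₂
substW φ = concatMap f
  where
  f : Letter AB → F₂
  f (pos x) = φ x
  f (neg x) = invW (φ x)

imgR : Letter AB → AB → F₂
imgR (pos a) a = pos a ∷ []
imgR (pos a) b = pos b ∷ pos a ∷ []
imgR (neg a) a = pos a ∷ []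
imgR (neg a) b = pos b ∷ neg a ∷ []
imgR (pos b) a = pos a ∷ pos b ∷ []
imgR (pos b) b = pos b ∷ []
imgR (neg b) a = pos a ∷ neg b ∷ []
imgR (neg b) b = pos b ∷ []

R : F₂ → F₂ → F₂
R []      u = u
R (x ∷ w) u = substW (imgR x) (R w u)

Pal : F₂ → F₂
Pal w = neg b ∷ neg a ∷ R w (pos a ∷ pos b ∷ [])

βL : Letter AB → Letter Σgen
βL (pos a) = pos σ₁
βL (neg a) = neg σ₁
βL (pos b) = neg σ₂
βL (neg b) = pos σ₂

β : F₂ → B₃
β = map βL

nGen : B₃
nGen = pos σ₁ ∷ neg σ₂ ∷ neg σ₁ ∷ []

InN : B₃ → Set
InN g = ∃ λ (k : ℤ) → g ≈B powW nGen k

module Submission where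

-- B₃ acts on F₂ by σ₁ ↦ R_a, σ₂ ↦ R_b⁻¹ (act), and R_w = act (β w); since
-- Pal w = (ab)⁻¹ R_w(ab), the claim is that N is the stabiliser of ab. The
-- generator n of N fixes ab by direct computation. Conversely, conjugation by
-- σ₂ carries the stabiliser of ab to that of a, and σ₂⁻¹σ₁σ₂ = n⁻¹, so it
-- suffices that the stabiliser of a is ⟨σ₁⟩. For this, every braid is
-- written as r·Zᵐσ₁ᵏ with Z = Δ² central and r an alternating word in Δ and
-- Y = σ₁σ₂ (normal forms for B₃/⟨Z⟩ ≅ ℤ/2 ∗ ℤ/3). Abelianising the action
-- gives the SL₂(ℤ)-action on ℤ², where a ping-pong argument shows r = 1 when
-- a is fixed; an action of F₂ on ℤ by a reflection and a translation, whose
-- reflection centre Z shifts by one, then forces m = 0.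

open import Defs
open import Data.List using (List; []; _∷_; _++_; [_]; reverse; map; concatMap)
open import Data.List.Properties
  using (++-assoc; ++-identityʳ; map-++; reverse-++; unfold-reverse; concatMap-++)
open import Data.List.Relation.Unary.Any using (here; there)
open import Data.Product using (∃; _×_; _,_; proj₁; proj₂)
open import Data.Sum using (_⊎_; inj₁; inj₂)
open import Data.Unit using (⊤; tt)
open import Data.Empty using (⊥-elim)
open import Data.Bool using (Bool; true; false)
open import Data.Nat as ℕ using (zero; z<s)
open import Data.Integer as ℤ
  using (ℤ; +_; -[1+_]; _+_; -_; _*_; _<_; +<+; -<+)
open import Data.Integer.Properties using (+-identityˡ; +-assoc; suc-pred; neg-mono-<; +-mono-<)
open import Data.Integer.Tactic.RingSolver using (solve-∀)
open import Function.Bundles using (_⇔_; mk⇔; Equivalence)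
open import Relation.Nullary using (¬_)
open import Relation.Binary.Bundles using (Setoid)
open import Relation.Binary.PropositionalEquality
  using (_≡_; refl; sym; trans; cong; cong₂; subst; subst₂; module ≡-Reasoning)
import Relation.Binary.Reasoning.Setoid as SetoidReasoning

wordSetoid : {G : Set} → List (Word G) → Setoid _ _
wordSetoid {G} Rs = record
  { Carrier       = Word G
  ; _≈_           = Eq⟨ Rs ⟩
  ; isEquivalence = record { refl = ≈refl ; sym = ≈sym ; trans = ≈trans }
  }

module ≈-Reasoning {G : Set} (Rs : List (Word G)) = SetoidReasoning (wordSetoid Rs)

invL-involutive : ∀ {G} (x : Letter G) → invL (invL x) ≡ x
invL-involutive (pos x) = refl
invL-involutive (neg x) = refl

invW-++ : ∀ {G} (u v : Word G) → invW (u ++ v) ≡ invW v ++ invW u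
invW-++ u v = trans (cong reverse (map-++ invL u v)) (reverse-++ (map invL u) (map invL v))

invW-involutive : ∀ {G} (w : Word G) → invW (invW w) ≡ w
invW-involutive [] = refl
invW-involutive (x ∷ w) = begin
  invW (invW (x ∷ w))            ≡⟨ cong invW (unfold-reverse (invL x) (map invL w)) ⟩
  invW (invW w ++ [ invL x ])    ≡⟨ invW-++ (invW w) [ invL x ] ⟩
  invL (invL x) ∷ invW (invW w)  ≡⟨ cong₂ _∷_ (invL-involutive x) (invW-involutive w) ⟩
  x ∷ w                          ∎
  where open ≡-Reasoning

module _ {G : Set} {Rs : List (Word G)} where

  private
    _≈_ : Word G → Word G → Set
    _≈_ = Eq⟨ Rs ⟩

  ≡⇒≈ : ∀ {u v} → u ≡ v → u ≈ v
  ≡⇒≈ refl = ≈refl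

  ∙-congˡ : ∀ p {u v} → u ≈ v → (p ++ u) ≈ (p ++ v)
  ∙-congˡ p ≈refl         = ≈refl
  ∙-congˡ p (≈sym d)      = ≈sym (∙-congˡ p d)
  ∙-congˡ p (≈trans d e)  = ≈trans (∙-congˡ p d) (∙-congˡ p e)
  ∙-congˡ p (≈free u v x) =
    subst₂ _≈_ (++-assoc p u (x ∷ invL x ∷ v)) (++-assoc p u v) (≈free (p ++ u) v x)
  ∙-congˡ p (≈rel u v r m) =
    subst₂ _≈_ (++-assoc p u (r ++ v)) (++-assoc p u v) (≈rel (p ++ u) v r m)

  ∙-congʳ : ∀ q {u v} → u ≈ v → (u ++ q) ≈ (v ++ q)
  ∙-congʳ q ≈refl         = ≈refl
  ∙-congʳ q (≈sym d)      = ≈sym (∙-congʳ q d)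
  ∙-congʳ q (≈trans d e)  = ≈trans (∙-congʳ q d) (∙-congʳ q e)
  ∙-congʳ q (≈free u v x) =
    subst₂ _≈_ (sym (++-assoc u (x ∷ invL x ∷ v) q)) (sym (++-assoc u v q)) (≈free u (v ++ q) x)
  ∙-congʳ q (≈rel u v r m) =
    subst₂ _≈_ (sym (trans (++-assoc u (r ++ v) q) (cong (u ++_) (++-assoc r v q))))
      (sym (++-assoc u v q)) (≈rel u (v ++ q) r m)

  ∙-cong : ∀ {u u′ v v′} → u ≈ u′ → v ≈ v′ → (u ++ v) ≈ (u′ ++ v′)
  ∙-cong {u′ = u′} {v = v} d e = ≈trans (∙-congʳ v d) (∙-congˡ u′ e)

  cancel : ∀ x v → (x ∷ invL x ∷ v) ≈ v
  cancel x v = ≈free [] v x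

  cancel′ : ∀ x v → (invL x ∷ x ∷ v) ≈ v
  cancel′ x v = subst (λ y → (invL x ∷ y ∷ v) ≈ v) (invL-involutive x) (cancel (invL x) v)

  inverseʳ : ∀ w v → (w ++ invW w ++ v) ≈ v
  inverseʳ []      v = ≈refl
  inverseʳ (x ∷ w) v =
    ≈trans (≡⇒≈ (cong (λ z → x ∷ w ++ z) shape))
      (≈trans (∙-congˡ [ x ] (inverseʳ w (invL x ∷ v))) (cancel x v))
    where
    shape : invW (x ∷ w) ++ v ≡ invW w ++ invL x ∷ v
    shape = trans (cong (_++ v) (unfold-reverse (invL x) (map invL w))) (++-assoc (invW w) _ v)

  inverseˡ : ∀ w v → (invW w ++ w ++ v) ≈ v
  inverseˡ w v = subst (λ z → (invW w ++ z ++ v) ≈ v) (invW-involutive w) (inverseʳ (invW w) v)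

  inverseʳ₀ : ∀ w → (w ++ invW w) ≈ []
  inverseʳ₀ w = subst (λ z → (w ++ z) ≈ []) (++-identityʳ (invW w)) (inverseʳ w [])

  pow-suc : ∀ u k → (u ++ powW u k) ≈ powW u (ℤ.suc k)
  pow-suc u (+ n)            = ≈refl
  pow-suc u -[1+ zero ]      = inverseʳ u []
  pow-suc u -[1+ ℕ.suc n ]   = inverseʳ u _

  pow-pred : ∀ u k → (invW u ++ powW u k) ≈ powW u (ℤ.pred k)
  pow-pred u (+ zero)    = ≈refl
  pow-pred u (+ ℕ.suc n) = inverseˡ u _
  pow-pred u -[1+ n ]    = ≈refl

  pow-cong : ∀ {u u′} → u ≈ u′ → ∀ n → powW u (+ n) ≈ powW u′ (+ n)
  pow-cong d zero      = ≈refl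
  pow-cong d (ℕ.suc n) = ∙-cong d (pow-cong d n)

  conj-pow : ∀ x u n → powW (invL x ∷ u ++ [ x ]) (+ n) ≈ (invL x ∷ powW u (+ n) ++ [ x ])
  conj-pow x u zero      = ≈sym (cancel′ x [])
  conj-pow x u (ℕ.suc n) = begin
    (invL x ∷ u ++ [ x ]) ++ powW (invL x ∷ u ++ [ x ]) (+ n)
      ≈⟨ ∙-congˡ (invL x ∷ u ++ [ x ]) (conj-pow x u n) ⟩
    (invL x ∷ u ++ [ x ]) ++ invL x ∷ uⁿ ++ [ x ]
      ≡⟨ cong (invL x ∷_) (++-assoc u [ x ] _) ⟩
    invL x ∷ u ++ x ∷ invL x ∷ uⁿ ++ [ x ]
      ≈⟨ ≈free (invL x ∷ u) (uⁿ ++ [ x ]) x ⟩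
    invL x ∷ u ++ uⁿ ++ [ x ]
      ≡⟨ cong (invL x ∷_) (++-assoc u uⁿ [ x ]) ⟨
    invL x ∷ (u ++ uⁿ) ++ [ x ]
      ∎
    where
    open ≈-Reasoning Rs
    uⁿ = powW u (+ n)

  Central : Word G → Set
  Central A = ∀ u → (A ++ u) ≈ (u ++ A)

  central-prefix : ∀ {A} → Central A → ∀ u t → (A ++ u ++ t) ≈ (u ++ A ++ t)
  central-prefix {A} c u t =
    ≈trans (≡⇒≈ (sym (++-assoc A u t)))
      (≈trans (∙-congʳ t (c u)) (≡⇒≈ (++-assoc u A t)))

  central-inv : ∀ {A} → Central A → Central (invW A)
  central-inv {A} c u = ≈sym (begin
    u ++ A⁻¹                      ≈⟨ inverseˡ A _ ⟨
    A⁻¹ ++ A ++ u ++ A⁻¹          ≡⟨ cong (A⁻¹ ++_) (++-assoc A u A⁻¹) ⟨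
    A⁻¹ ++ (A ++ u) ++ A⁻¹        ≈⟨ ∙-congˡ A⁻¹ (∙-congʳ A⁻¹ (c u)) ⟩
    A⁻¹ ++ (u ++ A) ++ A⁻¹        ≡⟨ cong (A⁻¹ ++_) (++-assoc u A A⁻¹) ⟩
    A⁻¹ ++ u ++ A ++ A⁻¹          ≈⟨ ∙-congˡ A⁻¹ (∙-congˡ u (inverseʳ₀ A)) ⟩
    A⁻¹ ++ u ++ []                ≡⟨ cong (A⁻¹ ++_) (++-identityʳ u) ⟩
    A⁻¹ ++ u                      ∎)
    where
    open ≈-Reasoning Rs
    A⁻¹ = invW A

  central-powℕ : ∀ {A} → Central A → ∀ n → Central (powW A (+ n))
  central-powℕ c zero      u = ≡⇒≈ (sym (++-identityʳ u))
  central-powℕ {A} c (ℕ.suc n) u = begin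
    (A ++ Aⁿ) ++ u   ≡⟨ ++-assoc A Aⁿ u ⟩
    A ++ Aⁿ ++ u     ≈⟨ ∙-congˡ A (central-powℕ c n u) ⟩
    A ++ u ++ Aⁿ     ≈⟨ central-prefix c u Aⁿ ⟩
    u ++ A ++ Aⁿ     ∎
    where
    open ≈-Reasoning Rs
    Aⁿ = powW A (+ n)

  central-pow : ∀ {A} → Central A → ∀ k → Central (powW A k)
  central-pow c (+ n)    = central-powℕ c n
  central-pow c -[1+ n ] = central-powℕ (central-inv c) (ℕ.suc n)

  inverse-solve : ∀ p u → (invW p ++ u) ≈ [] ⇔ u ≈ p
  inverse-solve p u = mk⇔ to from
    where
    open ≈-Reasoning Rs
    to : (invW p ++ u) ≈ [] → u ≈ p
    to d = begin
      u                   ≈⟨ inverseʳ p u ⟨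
      p ++ invW p ++ u    ≈⟨ ∙-congˡ p d ⟩
      p ++ []             ≡⟨ ++-identityʳ p ⟩
      p                   ∎
    from : u ≈ p → (invW p ++ u) ≈ []
    from d = begin
      invW p ++ u         ≈⟨ ∙-congˡ (invW p) d ⟩
      invW p ++ p         ≡⟨ cong (invW p ++_) (++-identityʳ p) ⟨
      invW p ++ p ++ []   ≈⟨ inverseˡ p [] ⟩
      []                  ∎

  letters-commute : ∀ A (f : Letter G → Letter G) → (∀ ℓ → (A ++ [ ℓ ]) ≈ (f ℓ ∷ A)) →
                    ∀ u → (A ++ u) ≈ (map f u ++ A)
  letters-commute A f h []      = ≡⇒≈ (++-identityʳ A)
  letters-commute A f h (ℓ ∷ u) = begin
    A ++ ℓ ∷ u             ≡⟨ ++-assoc A [ ℓ ] u ⟨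
    (A ++ [ ℓ ]) ++ u      ≈⟨ ∙-congʳ u (h ℓ) ⟩
    f ℓ ∷ A ++ u           ≈⟨ ∙-congˡ [ f ℓ ] (letters-commute A f h u) ⟩
    f ℓ ∷ map f u ++ A     ∎
    where open ≈-Reasoning Rs

  conj-inv : ∀ A ℓ ℓ′ → (A ++ [ ℓ ]) ≈ (ℓ′ ∷ A) → (A ++ [ invL ℓ ]) ≈ (invL ℓ′ ∷ A)
  conj-inv A ℓ ℓ′ h = begin
    A ++ [ invL ℓ ]                       ≈⟨ cancel′ ℓ′ _ ⟨
    invL ℓ′ ∷ ℓ′ ∷ A ++ [ invL ℓ ]        ≈⟨ ∙-congˡ [ invL ℓ′ ] (∙-congʳ [ invL ℓ ] h) ⟨
    invL ℓ′ ∷ (A ++ [ ℓ ]) ++ [ invL ℓ ]  ≡⟨ cong (invL ℓ′ ∷_) (++-assoc A [ ℓ ] [ invL ℓ ]) ⟩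
    invL ℓ′ ∷ A ++ ℓ ∷ invL ℓ ∷ []        ≈⟨ ≈free (invL ℓ′ ∷ A) [] ℓ ⟩
    invL ℓ′ ∷ A ++ []                     ≡⟨ cong (invL ℓ′ ∷_) (++-identityʳ A) ⟩
    invL ℓ′ ∷ A                           ∎
    where open ≈-Reasoning Rs

  unconjugate : ∀ x g → g ≈ (invL x ∷ (x ∷ g ++ [ invL x ]) ++ [ x ])
  unconjugate x g = ≈sym (begin
    invL x ∷ (x ∷ g ++ [ invL x ]) ++ [ x ]   ≈⟨ cancel′ x _ ⟩
    (g ++ [ invL x ]) ++ [ x ]                ≡⟨ ++-assoc g [ invL x ] [ x ] ⟩
    g ++ invL x ∷ x ∷ []                      ≈⟨ ∙-congˡ g (cancel′ x []) ⟩
    g ++ []                                   ≡⟨ ++-identityʳ g ⟩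
    g                                         ∎)
    where open ≈-Reasoning Rs

-- Free reduction in F₂: reduce w is a freely equal word, so two words with
-- the same reduction are equal in F₂. This decides concrete identities.
inversePair? : (x y : Letter AB) → (y ≡ invL x) ⊎ ⊤
inversePair? (pos a) (neg a) = inj₁ refl
inversePair? (neg a) (pos a) = inj₁ refl
inversePair? (pos b) (neg b) = inj₁ refl
inversePair? (neg b) (pos b) = inj₁ refl
inversePair? _       _       = inj₂ tt

push : Letter AB → F₂ → F₂
push x []       = [ x ]
push x (y ∷ ys) with inversePair? x y
... | inj₁ _ = ys
... | inj₂ _ = x ∷ y ∷ ys

reduce : F₂ → F₂
reduce []      = []
reduce (x ∷ w) = push x (reduce w)

push-sound : ∀ x w → (x ∷ w) ≈F push x w
push-sound x []       = ≈refl
push-sound x (y ∷ ys) with inversePair? x y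
... | inj₁ refl = cancel x ys
... | inj₂ _    = ≈refl

reduce-sound : ∀ w → w ≈F reduce w
reduce-sound []      = ≈refl
reduce-sound (x ∷ w) = ≈trans (∙-congˡ [ x ] (reduce-sound w)) (push-sound x (reduce w))

by-reduction : ∀ u v → reduce u ≡ reduce v → u ≈F v
by-reduction u v e = ≈trans (reduce-sound u) (≈trans (≡⇒≈ e) (≈sym (reduce-sound v)))

everyLetter : (P : Letter AB → Set) → P (pos a) → P (neg a) → P (pos b) → P (neg b) → ∀ ℓ → P ℓ
everyLetter P pa na pb nb (pos a) = pa
everyLetter P pa na pb nb (neg a) = na
everyLetter P pa na pb nb (pos b) = pb
everyLetter P pa na pb nb (neg b) = nb

substW-++ : ∀ φ u v → substW φ (u ++ v) ≡ substW φ u ++ substW φ v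
substW-++ φ u v = concatMap-++ _ u v

substW-cong : ∀ φ {u v} → u ≈F v → substW φ u ≈F substW φ v
substW-cong φ ≈refl         = ≈refl
substW-cong φ (≈sym d)      = ≈sym (substW-cong φ d)
substW-cong φ (≈trans d e)  = ≈trans (substW-cong φ d) (substW-cong φ e)
substW-cong φ (≈free u v x) =
  ≈trans (≡⇒≈ (substW-++ φ u _))
    (≈trans (∙-congˡ (substW φ u) (cancelPair x)) (≡⇒≈ (sym (substW-++ φ u v))))
  where
  cancelPair : ∀ x → substW φ (x ∷ invL x ∷ v) ≈F substW φ v
  cancelPair (pos x) = inverseʳ (φ x) _
  cancelPair (neg x) = inverseˡ (φ x) _
substW-cong φ (≈rel u v r ())

imgσ : Letter Σgen → AB → F₂
imgσ (pos σ₁) = imgR (pos a)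
imgσ (neg σ₁) = imgR (neg a)
imgσ (pos σ₂) = imgR (neg b)
imgσ (neg σ₂) = imgR (pos b)

act : B₃ → F₂ → F₂
act []      z = z
act (x ∷ g) z = substW (imgσ x) (act g z)

R-is-act-β : ∀ w z → R w z ≡ act (β w) z
R-is-act-β []      z = refl
R-is-act-β (ℓ ∷ w) z = cong₂ substW (imgσ-β ℓ) (R-is-act-β w z)
  where
  imgσ-β : ∀ ℓ → imgR ℓ ≡ imgσ (βL ℓ)
  imgσ-β (pos a) = refl
  imgσ-β (neg a) = refl
  imgσ-β (pos b) = refl
  imgσ-β (neg b) = refl

act-++ : ∀ g h z → act (g ++ h) z ≡ act g (act h z)
act-++ []      h z = refl
act-++ (x ∷ g) h z = cong (substW (imgσ x)) (act-++ g h z)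

act-hom : ∀ g u v → act g (u ++ v) ≡ act g u ++ act g v
act-hom []      u v = refl
act-hom (x ∷ g) u v =
  trans (cong (substW (imgσ x)) (act-hom g u v)) (substW-++ (imgσ x) (act g u) (act g v))

act-cong : ∀ g {u v} → u ≈F v → act g u ≈F act g v
act-cong []      d = d
act-cong (x ∷ g) d = substW-cong (imgσ x) (act-cong g d)

act-[] : ∀ g → act g [] ≡ []
act-[] []      = refl
act-[] (x ∷ g) = cong (substW (imgσ x)) (act-[] g)

fixes-letters : ∀ g → (∀ ℓ → act g [ ℓ ] ≈F [ ℓ ]) → ∀ z → act g z ≈F z
fixes-letters g h []      = ≡⇒≈ (act-[] g)
fixes-letters g h (ℓ ∷ z) =
  ≈trans (≡⇒≈ (act-hom g [ ℓ ] z)) (∙-cong (h ℓ) (fixes-letters g h z))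

fixes-by-reduction : ∀ g → (∀ ℓ → reduce (act g [ ℓ ]) ≡ [ ℓ ]) → ∀ z → act g z ≈F z
fixes-by-reduction g h = fixes-letters g (λ ℓ → by-reduction _ _ (h ℓ))

act-insert : ∀ r → (∀ z → act r z ≈F z) → ∀ u v z → act (u ++ r ++ v) z ≈F act (u ++ v) z
act-insert r triv u v z = begin
  act (u ++ r ++ v) z       ≡⟨ trans (act-++ u (r ++ v) z) (cong (act u) (act-++ r v z)) ⟩
  act u (act r (act v z))   ≈⟨ act-cong u (triv (act v z)) ⟩
  act u (act v z)           ≡⟨ act-++ u v z ⟨
  act (u ++ v) z            ∎
  where open ≈-Reasoning []

pair-trivial : ∀ x z → act (x ∷ invL x ∷ []) z ≈F z
pair-trivial x = fixes-by-reduction (x ∷ invL x ∷ []) (on-letters x)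
  where
  on-letters : ∀ x ℓ → reduce (act (x ∷ invL x ∷ []) [ ℓ ]) ≡ [ ℓ ]
  on-letters (pos σ₁) = everyLetter _ refl refl refl refl
  on-letters (neg σ₁) = everyLetter _ refl refl refl refl
  on-letters (pos σ₂) = everyLetter _ refl refl refl refl
  on-letters (neg σ₂) = everyLetter _ refl refl refl refl

braid-trivial : ∀ z → act braidRelator z ≈F z
braid-trivial = fixes-by-reduction braidRelator (everyLetter _ refl refl refl refl)

act-respects-B₃ : ∀ {g h} → g ≈B h → ∀ z → act g z ≈F act h z
act-respects-B₃ ≈refl                     z = ≈refl
act-respects-B₃ (≈sym d)                  z = ≈sym (act-respects-B₃ d z)
act-respects-B₃ (≈trans d e)              z = ≈trans (act-respects-B₃ d z) (act-respects-B₃ e z)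
act-respects-B₃ (≈free u v x)             z = act-insert (x ∷ invL x ∷ []) (pair-trivial x) u v z
act-respects-B₃ (≈rel u v r (here refl))  z = act-insert braidRelator braid-trivial u v z
act-respects-B₃ (≈rel u v r (there ()))   z

-- Braid identities. With Y = σ₁σ₂ and Δ = σ₁σ₂σ₁ one has Δ² = Y³ = Z, and
-- conjugation by Δ swaps σ₁ and σ₂, so Z is central; B₃/⟨Z⟩ is the free
-- product of ⟨Δ⟩ ≅ ℤ/2 and ⟨Y⟩ ≅ ℤ/3.
s₁ s₂ s₁⁻¹ s₂⁻¹ : Letter Σgen
s₁   = pos σ₁
s₂   = pos σ₂
s₁⁻¹ = neg σ₁
s₂⁻¹ = neg σ₂

Δ Y Z Z⁻¹ : B₃
Δ   = s₁ ∷ s₂ ∷ s₁ ∷ []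
Y   = s₁ ∷ s₂ ∷ []
Z   = Δ ++ Δ
Z⁻¹ = invW Z

braid : ∀ q → (s₁ ∷ s₂ ∷ s₁ ∷ q) ≈B (s₂ ∷ s₁ ∷ s₂ ∷ q)
braid q = ≈trans (∙-congˡ Δ (≈sym (inverseˡ (s₂ ∷ s₁ ∷ s₂ ∷ []) q)))
                 (≈rel [] (s₂ ∷ s₁ ∷ s₂ ∷ q) braidRelator (here refl))

Y³≈Z : ∀ q → (Y ++ Y ++ Y ++ q) ≈B (Z ++ q)
Y³≈Z q = ∙-congˡ Δ (≈sym (braid q))

swap : Letter Σgen → Letter Σgen
swap (pos σ₁) = pos σ₂
swap (pos σ₂) = pos σ₁
swap (neg σ₁) = neg σ₂
swap (neg σ₂) = neg σ₁

Δ-conj-letter : ∀ ℓ → (Δ ++ [ ℓ ]) ≈B (swap ℓ ∷ Δ)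
Δ-conj-letter (pos σ₁) = braid [ s₁ ]
Δ-conj-letter (pos σ₂) = ∙-congˡ [ s₁ ] (≈sym (braid []))
Δ-conj-letter (neg σ₁) = conj-inv Δ s₁ s₂ (braid [ s₁ ])
Δ-conj-letter (neg σ₂) = conj-inv Δ s₂ s₁ (∙-congˡ [ s₁ ] (≈sym (braid [])))

swap-swap : ∀ u → map swap (map swap u) ≡ u
swap-swap []             = refl
swap-swap (pos σ₁ ∷ u)   = cong (s₁ ∷_) (swap-swap u)
swap-swap (pos σ₂ ∷ u)   = cong (s₂ ∷_) (swap-swap u)
swap-swap (neg σ₁ ∷ u)   = cong (s₁⁻¹ ∷_) (swap-swap u)
swap-swap (neg σ₂ ∷ u)   = cong (s₂⁻¹ ∷_) (swap-swap u)

Z-central : Central Z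
Z-central u = begin
  Δ ++ Δ ++ u                            ≈⟨ ∙-congˡ Δ (Δ-conj u) ⟩
  Δ ++ map swap u ++ Δ                   ≡⟨ ++-assoc Δ (map swap u) Δ ⟨
  (Δ ++ map swap u) ++ Δ                 ≈⟨ ∙-congʳ Δ (Δ-conj (map swap u)) ⟩
  (map swap (map swap u) ++ Δ) ++ Δ      ≡⟨ cong (λ v → (v ++ Δ) ++ Δ) (swap-swap u) ⟩
  (u ++ Δ) ++ Δ                          ≡⟨ ++-assoc u Δ Δ ⟩
  u ++ Z                                 ∎
  where
  open ≈-Reasoning (braidRelator ∷ [])
  Δ-conj : ∀ u → (Δ ++ u) ≈B (map swap u ++ Δ)
  Δ-conj = letters-commute Δ swap Δ-conj-letter

ΔY≈ : ∀ t → (Δ ++ Y ++ t) ≈B (s₁⁻¹ ∷ Z ++ t)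
ΔY≈ t = ≈sym (begin
  s₁⁻¹ ∷ s₁ ∷ s₂ ∷ s₁ ∷ s₁ ∷ s₂ ∷ s₁ ∷ t   ≈⟨ cancel′ s₁ _ ⟩
  s₂ ∷ s₁ ∷ s₁ ∷ s₂ ∷ s₁ ∷ t               ≈⟨ ∙-congˡ (s₂ ∷ s₁ ∷ []) (braid t) ⟩
  s₂ ∷ s₁ ∷ s₂ ∷ s₁ ∷ s₂ ∷ t               ≈⟨ braid (s₁ ∷ s₂ ∷ t) ⟨
  s₁ ∷ s₂ ∷ s₁ ∷ s₁ ∷ s₂ ∷ t               ∎)
  where open ≈-Reasoning (braidRelator ∷ [])

YΔ≈ : ∀ t → (Y ++ Δ ++ t) ≈B (s₂⁻¹ ∷ Z ++ t)
YΔ≈ t = ≈sym (begin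
  s₂⁻¹ ∷ s₁ ∷ s₂ ∷ s₁ ∷ s₁ ∷ s₂ ∷ s₁ ∷ t   ≈⟨ ∙-congˡ [ s₂⁻¹ ] (braid _) ⟩
  s₂⁻¹ ∷ s₂ ∷ s₁ ∷ s₂ ∷ s₁ ∷ s₂ ∷ s₁ ∷ t   ≈⟨ cancel′ s₂ _ ⟩
  s₁ ∷ s₂ ∷ s₁ ∷ s₂ ∷ s₁ ∷ t               ∎)
  where open ≈-Reasoning (braidRelator ∷ [])

-- Normal forms. Every braid is r·h with h in the abelian subgroup
-- H = ⟨σ₁, Z⟩ and r one of the representatives below: 1, Y, or an
-- alternating product of Δ and Y^{±1} (Y² = Y⁻¹Z) ending in Y².
data Alt : Set where
  last : Alt
  more : Bool → Alt → Alt

data Rep : Set where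
  one y¹     : Rep
  y-alt Δ-alt : Alt → Rep

⟦_⟧A : Alt → B₃
⟦ last ⟧A         = Y ++ Y
⟦ more false r ⟧A = Y ++ Δ ++ ⟦ r ⟧A
⟦ more true r ⟧A  = Y ++ Y ++ Δ ++ ⟦ r ⟧A

⟦_⟧R : Rep → B₃
⟦ one ⟧R     = []
⟦ y¹ ⟧R      = Y
⟦ y-alt r ⟧R = ⟦ r ⟧A
⟦ Δ-alt r ⟧R = Δ ++ ⟦ r ⟧A

data HGen : Set where
  t⁺ t⁻ z⁺ z⁻ : HGen

⟦_⟧h : HGen → B₃
⟦ t⁺ ⟧h = [ s₁ ]
⟦ t⁻ ⟧h = [ s₁⁻¹ ]
⟦ z⁺ ⟧h = Z
⟦ z⁻ ⟧h = Z⁻¹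

⟦_⟧H : List HGen → B₃
⟦ e ⟧H = concatMap ⟦_⟧h e

NF : Set
NF = Rep × List HGen

⟦_⟧N : NF → B₃
⟦ r , e ⟧N = ⟦ r ⟧R ++ ⟦ e ⟧H

_⊲_ : NF → B₃ → B₃
(r , e) ⊲ t = ⟦ r ⟧R ++ ⟦ e ⟧H ++ t

-- Left multiplication of a representative by Δ or Y gives a representative
-- times a word in H (Δ·1 = Y·σ₁, Δ·Y = σ₁⁻¹Z, Δ² = Z, Y³ = Z).
data Op : Set where
  opΔ opY : Op

⟦_⟧op : Op → B₃
⟦ opΔ ⟧op = Δ
⟦ opY ⟧op = Y

stepRep : Op → Rep → Rep × List HGen
stepRep opΔ one                  = y¹ , [ t⁺ ]
stepRep opΔ y¹                   = one , t⁻ ∷ z⁺ ∷ []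
stepRep opΔ (y-alt r)            = Δ-alt r , []
stepRep opΔ (Δ-alt r)            = y-alt r , [ z⁺ ]
stepRep opY one                  = y¹ , []
stepRep opY y¹                   = y-alt last , []
stepRep opY (y-alt last)         = one , [ z⁺ ]
stepRep opY (y-alt (more false r)) = y-alt (more true r) , []
stepRep opY (y-alt (more true r))  = Δ-alt r , [ z⁺ ]
stepRep opY (Δ-alt r)            = y-alt (more false r) , []

stepRep-sound : ∀ o r t → (⟦ o ⟧op ++ ⟦ r ⟧R ++ t) ≈B (stepRep o r ⊲ t)
stepRep-sound opΔ one t                  = ≈refl
stepRep-sound opΔ y¹ t                   = ΔY≈ t
stepRep-sound opΔ (y-alt r) t            = ≡⇒≈ (sym (++-assoc Δ ⟦ r ⟧A t))
stepRep-sound opΔ (Δ-alt r) t            =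
  ≈trans (≡⇒≈ (cong (Δ ++_) (++-assoc Δ ⟦ r ⟧A t))) (central-prefix Z-central ⟦ r ⟧A t)
stepRep-sound opY one t                  = ≈refl
stepRep-sound opY y¹ t                   = ≈refl
stepRep-sound opY (y-alt last) t         = Y³≈Z t
stepRep-sound opY (y-alt (more false r)) t = ≈refl
stepRep-sound opY (y-alt (more true r)) t  =
  ≈trans (Y³≈Z (Δ ++ ⟦ r ⟧A ++ t)) (central-prefix Z-central (Δ ++ ⟦ r ⟧A) t)
stepRep-sound opY (Δ-alt r) t            = ≈refl

pushOp : Op → NF → NF
pushOp o (r , e) = proj₁ (stepRep o r) , proj₂ (stepRep o r) ++ e

pushOp-sound : ∀ o nf → (⟦ o ⟧op ++ ⟦ nf ⟧N) ≈B ⟦ pushOp o nf ⟧N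
pushOp-sound o (r , e) = begin
  ⟦ o ⟧op ++ ⟦ r ⟧R ++ ⟦ e ⟧H      ≈⟨ stepRep-sound o r ⟦ e ⟧H ⟩
  ⟦ r′ ⟧R ++ ⟦ e′ ⟧H ++ ⟦ e ⟧H     ≡⟨ cong (⟦ r′ ⟧R ++_) (concatMap-++ ⟦_⟧h e′ e) ⟨
  ⟦ r′ ⟧R ++ ⟦ e′ ++ e ⟧H          ∎
  where
  open ≈-Reasoning (braidRelator ∷ [])
  r′ = proj₁ (stepRep o r)
  e′ = proj₂ (stepRep o r)

pushOps : List Op → NF → NF
pushOps []       nf = nf
pushOps (o ∷ os) nf = pushOp o (pushOps os nf)

⟦_⟧ops : List Op → B₃
⟦ os ⟧ops = concatMap ⟦_⟧op os

pushOps-sound : ∀ os nf → (⟦ os ⟧ops ++ ⟦ nf ⟧N) ≈B ⟦ pushOps os nf ⟧N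
pushOps-sound []       nf = ≈refl
pushOps-sound (o ∷ os) nf = begin
  (⟦ o ⟧op ++ ⟦ os ⟧ops) ++ ⟦ nf ⟧N    ≡⟨ ++-assoc ⟦ o ⟧op ⟦ os ⟧ops ⟦ nf ⟧N ⟩
  ⟦ o ⟧op ++ ⟦ os ⟧ops ++ ⟦ nf ⟧N      ≈⟨ ∙-congˡ ⟦ o ⟧op (pushOps-sound os nf) ⟩
  ⟦ o ⟧op ++ ⟦ pushOps os nf ⟧N        ≈⟨ pushOp-sound o (pushOps os nf) ⟩
  ⟦ pushOp o (pushOps os nf) ⟧N        ∎
  where open ≈-Reasoning (braidRelator ∷ [])

-- Each generator times Z is a word in Δ and Y:
-- Y²Δ = Zσ₁, ΔY² = Zσ₂, ΔY = σ₁⁻¹Z, YΔ = σ₂⁻¹Z.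
opsOf : Letter Σgen → List Op
opsOf (pos σ₁) = opY ∷ opY ∷ opΔ ∷ []
opsOf (pos σ₂) = opΔ ∷ opY ∷ opY ∷ []
opsOf (neg σ₁) = opΔ ∷ opY ∷ []
opsOf (neg σ₂) = opY ∷ opΔ ∷ []

opsOf-sound : ∀ ℓ t → (⟦ opsOf ℓ ⟧ops ++ t) ≈B (ℓ ∷ Z ++ t)
opsOf-sound (pos σ₁) t = ≈trans (Y³≈Z (s₁ ∷ t)) (central-prefix Z-central [ s₁ ] t)
opsOf-sound (pos σ₂) t = central-prefix Z-central [ s₂ ] t
opsOf-sound (neg σ₁) t = ΔY≈ t
opsOf-sound (neg σ₂) t = YΔ≈ t

withZ⁻¹ : NF → NF
withZ⁻¹ (r , e) = r , z⁻ ∷ e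

pushLetter-sound : ∀ ℓ nf → (ℓ ∷ ⟦ nf ⟧N) ≈B ⟦ pushOps (opsOf ℓ) (withZ⁻¹ nf) ⟧N
pushLetter-sound ℓ (r , e) = begin
  ℓ ∷ ⟦ r ⟧R ++ ⟦ e ⟧H                        ≈⟨ ∙-congˡ [ ℓ ] (inverseʳ Z _) ⟨
  ℓ ∷ Z ++ Z⁻¹ ++ ⟦ r ⟧R ++ ⟦ e ⟧H            ≈⟨ opsOf-sound ℓ _ ⟨
  ⟦ opsOf ℓ ⟧ops ++ Z⁻¹ ++ ⟦ r ⟧R ++ ⟦ e ⟧H   ≈⟨ ∙-congˡ ⟦ opsOf ℓ ⟧ops Z⁻¹-moves ⟩
  ⟦ opsOf ℓ ⟧ops ++ ⟦ r , z⁻ ∷ e ⟧N           ≈⟨ pushOps-sound (opsOf ℓ) (r , z⁻ ∷ e) ⟩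
  ⟦ pushOps (opsOf ℓ) (r , z⁻ ∷ e) ⟧N         ∎
  where
  open ≈-Reasoning (braidRelator ∷ [])
  Z⁻¹-moves : (Z⁻¹ ++ ⟦ r ⟧R ++ ⟦ e ⟧H) ≈B (⟦ r ⟧R ++ Z⁻¹ ++ ⟦ e ⟧H)
  Z⁻¹-moves = central-prefix (central-inv Z-central) ⟦ r ⟧R ⟦ e ⟧H

normalise : B₃ → NF
normalise []      = one , []
normalise (ℓ ∷ g) = pushOps (opsOf ℓ) (withZ⁻¹ (normalise g))

normalise-sound : ∀ g → g ≈B ⟦ normalise g ⟧N
normalise-sound []      = ≈refl
normalise-sound (ℓ ∷ g) =
  ≈trans (∙-congˡ [ ℓ ] (normalise-sound g)) (pushLetter-sound ℓ (normalise g))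

-- H = ⟨σ₁, Z⟩ is abelian (Z is central), so each word in H equals Zᵐσ₁ᵏ.
Z^ σ₁^ : ℤ → B₃
Z^ m  = powW Z m
σ₁^ k = powW [ s₁ ] k

⟦_⟧Zσ : ℤ × ℤ → B₃
⟦ m , k ⟧Zσ = Z^ m ++ σ₁^ k

addH : HGen → ℤ × ℤ → ℤ × ℤ
addH t⁺ (m , k) = m , ℤ.suc k
addH t⁻ (m , k) = m , ℤ.pred k
addH z⁺ (m , k) = ℤ.suc m , k
addH z⁻ (m , k) = ℤ.pred m , k

exponents : List HGen → ℤ × ℤ
exponents []      = + 0 , + 0
exponents (h ∷ e) = addH h (exponents e)

addH-sound : ∀ h mk → (⟦ h ⟧h ++ ⟦ mk ⟧Zσ) ≈B ⟦ addH h mk ⟧Zσ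
addH-sound t⁺ (m , k) =
  ≈trans (≈sym (central-prefix (central-pow Z-central m) [ s₁ ] (σ₁^ k)))
         (∙-congˡ (Z^ m) (pow-suc [ s₁ ] k))
addH-sound t⁻ (m , k) =
  ≈trans (≈sym (central-prefix (central-pow Z-central m) [ s₁⁻¹ ] (σ₁^ k)))
         (∙-congˡ (Z^ m) (pow-pred [ s₁ ] k))
addH-sound z⁺ (m , k) =
  ≈trans (≡⇒≈ (sym (++-assoc Z (Z^ m) (σ₁^ k)))) (∙-congʳ (σ₁^ k) (pow-suc Z m))
addH-sound z⁻ (m , k) =
  ≈trans (≡⇒≈ (sym (++-assoc Z⁻¹ (Z^ m) (σ₁^ k)))) (∙-congʳ (σ₁^ k) (pow-pred Z m))

exponents-sound : ∀ e → ⟦ e ⟧H ≈B ⟦ exponents e ⟧Zσ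
exponents-sound []      = ≈refl
exponents-sound (h ∷ e) = ≈trans (∙-congˡ ⟦ h ⟧h (exponents-sound e)) (addH-sound h (exponents e))

pow-fixes : ∀ u z → act u z ≈F z → ∀ n → act (powW u (+ n)) z ≈F z
pow-fixes u z fix zero      = ≈refl
pow-fixes u z fix (ℕ.suc n) =
  ≈trans (≡⇒≈ (act-++ u (powW u (+ n)) z)) (≈trans (act-cong u (pow-fixes u z fix n)) fix)

pow-fixesℤ : ∀ u z → act u z ≈F z → act (invW u) z ≈F z → ∀ k → act (powW u k) z ≈F z
pow-fixesℤ u z fix fix⁻¹ (+ n)    = pow-fixes u z fix n
pow-fixesℤ u z fix fix⁻¹ -[1+ n ] = pow-fixes (invW u) z fix⁻¹ (ℕ.suc n)

aW abW : F₂
aW  = [ pos a ]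
abW = pos a ∷ pos b ∷ []

σ₁^-fixes-a : ∀ k → act (σ₁^ k) aW ≈F aW
σ₁^-fixes-a = pow-fixesℤ [ s₁ ] aW ≈refl ≈refl

V : Set
V = ℤ × ℤ

infixl 6 _⊕_
infix 8 ⊖_

_⊕_ : V → V → V
(p , q) ⊕ (p′ , q′) = p + p′ , q + q′

⊖_ : V → V
⊖ (p , q) = - p , - q

0V e₁ : V
0V = + 0 , + 0
e₁ = + 1 , + 0

gen : AB → V
gen a = + 1 , + 0
gen b = + 0 , + 1

abL : Letter AB → V
abL (pos x) = gen x
abL (neg x) = ⊖ gen x

ab : F₂ → V
ab []      = 0V
ab (ℓ ∷ w) = abL ℓ ⊕ ab w

⊕-identityˡ : ∀ v → 0V ⊕ v ≡ v
⊕-identityˡ (p , q) = cong₂ _,_ (+-identityˡ p) (+-identityˡ q)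

⊕-assoc : ∀ u v w → (u ⊕ v) ⊕ w ≡ u ⊕ (v ⊕ w)
⊕-assoc (p , q) (p′ , q′) (p″ , q″) = cong₂ _,_ (+-assoc p p′ p″) (+-assoc q q′ q″)

⊕-cancel : ∀ u v → u ⊕ (⊖ u ⊕ v) ≡ v
⊕-cancel (p , q) (p′ , q′) = cong₂ _,_ (lemma p p′) (lemma q q′)
  where
  lemma : ∀ p p′ → p + (- p + p′) ≡ p′
  lemma = solve-∀

⊖-cancel : ∀ u v → ⊖ u ⊕ (u ⊕ v) ≡ v
⊖-cancel (p , q) (p′ , q′) = cong₂ _,_ (lemma p p′) (lemma q q′)
  where
  lemma : ∀ p p′ → - p + (p + p′) ≡ p′
  lemma = solve-∀

ab-++ : ∀ u v → ab (u ++ v) ≡ ab u ⊕ ab v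
ab-++ []      v = sym (⊕-identityˡ (ab v))
ab-++ (ℓ ∷ u) v = trans (cong (abL ℓ ⊕_) (ab-++ u v)) (sym (⊕-assoc (abL ℓ) (ab u) (ab v)))

ab-cong : ∀ {u v} → u ≈F v → ab u ≡ ab v
ab-cong ≈refl         = refl
ab-cong (≈sym d)      = sym (ab-cong d)
ab-cong (≈trans d e)  = trans (ab-cong d) (ab-cong e)
ab-cong (≈free u v x) =
  trans (ab-++ u (x ∷ invL x ∷ v)) (trans (cong (ab u ⊕_) (pair x)) (sym (ab-++ u v)))
  where
  pair : ∀ x → abL x ⊕ (abL (invL x) ⊕ ab v) ≡ ab v
  pair (pos x) = ⊕-cancel (gen x) (ab v)
  pair (neg x) = ⊖-cancel (gen x) (ab v)
ab-cong (≈rel u v r ())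

M : Letter Σgen → V → V
M (pos σ₁) (p , q) = p + q , q
M (neg σ₁) (p , q) = p + - q , q
M (pos σ₂) (p , q) = p , q + - p
M (neg σ₂) (p , q) = p , q + p

M-linear : ∀ ℓ u v → M ℓ (u ⊕ v) ≡ M ℓ u ⊕ M ℓ v
M-linear (pos σ₁) (p , q) (p′ , q′) = cong (_, q + q′) (add p q p′ q′)
  where
  add : ∀ p q p′ q′ → (p + p′) + (q + q′) ≡ (p + q) + (p′ + q′)
  add = solve-∀
M-linear (neg σ₁) (p , q) (p′ , q′) = cong (_, q + q′) (sub p q p′ q′)
  where
  sub : ∀ p q p′ q′ → (p + p′) + - (q + q′) ≡ (p + - q) + (p′ + - q′)
  sub = solve-∀
M-linear (pos σ₂) (p , q) (p′ , q′) = cong (p + p′ ,_) (sub q p q′ p′)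
  where
  sub : ∀ q p q′ p′ → (q + q′) + - (p + p′) ≡ (q + - p) + (q′ + - p′)
  sub = solve-∀
M-linear (neg σ₂) (p , q) (p′ , q′) = cong (p + p′ ,_) (add q p q′ p′)
  where
  add : ∀ q p q′ p′ → (q + q′) + (p + p′) ≡ (q + p) + (q′ + p′)
  add = solve-∀

M-zero : ∀ ℓ → M ℓ 0V ≡ 0V
M-zero (pos σ₁) = refl
M-zero (neg σ₁) = refl
M-zero (pos σ₂) = refl
M-zero (neg σ₂) = refl

ab-substW-letter : ∀ ℓ c → ab (substW (imgσ ℓ) [ c ]) ≡ M ℓ (abL c)
ab-substW-letter (pos σ₁) = everyLetter _ refl refl refl refl
ab-substW-letter (neg σ₁) = everyLetter _ refl refl refl refl
ab-substW-letter (pos σ₂) = everyLetter _ refl refl refl refl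
ab-substW-letter (neg σ₂) = everyLetter _ refl refl refl refl

ab-substW : ∀ ℓ z → ab (substW (imgσ ℓ) z) ≡ M ℓ (ab z)
ab-substW ℓ []      = sym (M-zero ℓ)
ab-substW ℓ (c ∷ z) = begin
  ab (substW (imgσ ℓ) (c ∷ z))                         ≡⟨ cong ab (substW-++ (imgσ ℓ) [ c ] z) ⟩
  ab (substW (imgσ ℓ) [ c ] ++ substW (imgσ ℓ) z)      ≡⟨ ab-++ (substW (imgσ ℓ) [ c ]) _ ⟩
  ab (substW (imgσ ℓ) [ c ]) ⊕ ab (substW (imgσ ℓ) z)  ≡⟨ cong₂ _⊕_ (ab-substW-letter ℓ c) (ab-substW ℓ z) ⟩
  M ℓ (abL c) ⊕ M ℓ (ab z)                             ≡⟨ M-linear ℓ (abL c) (ab z) ⟨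
  M ℓ (abL c ⊕ ab z)                                   ∎
  where open ≡-Reasoning

matrix : B₃ → V → V
matrix []      v = v
matrix (ℓ ∷ g) v = M ℓ (matrix g v)

matrix-++ : ∀ g h v → matrix (g ++ h) v ≡ matrix g (matrix h v)
matrix-++ []      h v = refl
matrix-++ (ℓ ∷ g) h v = cong (M ℓ) (matrix-++ g h v)

ab-act : ∀ g z → ab (act g z) ≡ matrix g (ab z)
ab-act []      z = refl
ab-act (ℓ ∷ g) z = trans (ab-substW ℓ (act g z)) (cong (M ℓ) (ab-act g z))

-- Ping-pong on ℤ²: Δ maps the open quadrants I ∪ III (SameSign) into
-- II ∪ IV (OppSign), while Y and Y² map II ∪ IV back into I ∪ III.
SameSign OppSign : V → Set
SameSign (p , q) = (+ 0 < p × + 0 < q) ⊎ (p < + 0 × q < + 0)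
OppSign  (p , q) = (+ 0 < p × q < + 0) ⊎ (p < + 0 × + 0 < q)

Δ-matrix : ∀ p q → matrix Δ (p , q) ≡ (q , - p)
Δ-matrix p q = cong₂ _,_ (first p q) (second p q)
  where
  first : ∀ p q → (p + q) + (q + - (p + q)) ≡ q
  first = solve-∀
  second : ∀ p q → q + - (p + q) ≡ - p
  second = solve-∀

Y-matrix : ∀ p q → matrix Y (p , q) ≡ (q , q + - p)
Y-matrix p q = cong (_, q + - p) (first p q)
  where
  first : ∀ p q → p + (q + - p) ≡ q
  first = solve-∀

Y²-matrix : ∀ p q → matrix (Y ++ Y) (p , q) ≡ (q + - p , - p)
Y²-matrix p q = trans (cong (matrix Y) (Y-matrix p q))
                      (trans (Y-matrix q (q + - p)) (cong (q + - p ,_) (second p q)))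
  where
  second : ∀ p q → (q + - p) + - q ≡ - p
  second = solve-∀

Δ-flip : ∀ v → SameSign v → OppSign (matrix Δ v)
Δ-flip (p , q) s = subst OppSign (sym (Δ-matrix p q)) (flip s)
  where
  flip : SameSign (p , q) → OppSign (q , - p)
  flip (inj₁ (p>0 , q>0)) = inj₁ (q>0 , neg-mono-< p>0)
  flip (inj₂ (p<0 , q<0)) = inj₂ (q<0 , neg-mono-< p<0)

Y-flip : ∀ v → OppSign v → SameSign (matrix Y v)
Y-flip (p , q) s = subst SameSign (sym (Y-matrix p q)) (flip s)
  where
  flip : OppSign (p , q) → SameSign (q , q + - p)
  flip (inj₁ (p>0 , q<0)) = inj₂ (q<0 , +-mono-< q<0 (neg-mono-< p>0))
  flip (inj₂ (p<0 , q>0)) = inj₁ (q>0 , +-mono-< q>0 (neg-mono-< p<0))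

Y²-flip : ∀ v → OppSign v → SameSign (matrix (Y ++ Y) v)
Y²-flip (p , q) s = subst SameSign (sym (Y²-matrix p q)) (flip s)
  where
  flip : OppSign (p , q) → SameSign (q + - p , - p)
  flip (inj₁ (p>0 , q<0)) = inj₂ (+-mono-< q<0 (neg-mono-< p>0) , neg-mono-< p>0)
  flip (inj₂ (p<0 , q>0)) = inj₁ (+-mono-< q>0 (neg-mono-< p<0) , neg-mono-< p<0)

data OnAxis : V → Set where
  +e₁ : OnAxis (+ 1 , + 0)
  -e₁ : OnAxis (-[1+ 0 ] , + 0)

H-axis : ∀ e {v} → OnAxis v → OnAxis (matrix ⟦ e ⟧H v)
H-axis []       v∈ = v∈
H-axis (h ∷ e) {v} v∈ =
  subst OnAxis (sym (matrix-++ ⟦ h ⟧h ⟦ e ⟧H v)) (generator h (H-axis e v∈))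
  where
  generator : ∀ h {w} → OnAxis w → OnAxis (matrix ⟦ h ⟧h w)
  generator t⁺ +e₁ = +e₁
  generator t⁺ -e₁ = -e₁
  generator t⁻ +e₁ = +e₁
  generator t⁻ -e₁ = -e₁
  generator z⁺ +e₁ = -e₁
  generator z⁺ -e₁ = +e₁
  generator z⁻ +e₁ = -e₁
  generator z⁻ -e₁ = +e₁

alt-same : ∀ r {v} → OnAxis v → SameSign (matrix ⟦ r ⟧A v)
alt-same last           +e₁ = inj₂ (-<+ , -<+)
alt-same last           -e₁ = inj₁ (+<+ z<s , +<+ z<s)
alt-same (more false r) v∈  = Y-flip _ (Δ-flip _ (alt-same r v∈))
alt-same (more true r)  v∈  = Y²-flip _ (Δ-flip _ (alt-same r v∈))

e₁-not-same : ¬ SameSign e₁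
e₁-not-same (inj₁ (_ , +<+ ()))
e₁-not-same (inj₂ (+<+ () , _))

e₁-not-opp : ¬ OppSign e₁
e₁-not-opp (inj₁ (_ , +<+ ()))
e₁-not-opp (inj₂ (+<+ () , _))

representative-fixing : ∀ r {v} → OnAxis v → matrix ⟦ r ⟧R v ≡ e₁ → r ≡ one
representative-fixing one       v∈  eq = refl
representative-fixing y¹        +e₁ ()
representative-fixing y¹        -e₁ ()
representative-fixing (y-alt r) v∈  eq = ⊥-elim (e₁-not-same (subst SameSign eq (alt-same r v∈)))
representative-fixing (Δ-alt r) v∈  eq =
  ⊥-elim (e₁-not-opp (subst OppSign eq (Δ-flip _ (alt-same r v∈))))

-- Hence a normal form fixing a has trivial representative: compare
-- abelianisations, ab a = e₁.
representative-trivial : ∀ r e → act ⟦ r , e ⟧N aW ≈F aW → r ≡ one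
representative-trivial r e fix = representative-fixing r (H-axis e +e₁) e₁-fixed
  where
  open ≡-Reasoning
  e₁-fixed : matrix ⟦ r ⟧R (matrix ⟦ e ⟧H e₁) ≡ e₁
  e₁-fixed = begin
    matrix ⟦ r ⟧R (matrix ⟦ e ⟧H e₁)  ≡⟨ matrix-++ ⟦ r ⟧R ⟦ e ⟧H e₁ ⟨
    matrix ⟦ r , e ⟧N (ab aW)         ≡⟨ ab-act ⟦ r , e ⟧N aW ⟨
    ab (act ⟦ r , e ⟧N aW)            ≡⟨ ab-cong fix ⟩
    e₁                                ∎

-- A second invariant detects powers of Z. For j ∈ ℤ, F₂ acts on ℤ by
-- isometries: a by the reflection y ↦ 2j − y, b by the translation y ↦ y + 1.
-- Since Z acts on F₂ by a ↦ ba⁻¹b⁻¹, b ↦ bab⁻¹a⁻¹b⁻¹, precomposing with Z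
-- moves the centre of the reflection from j to j + 1.
isom : ℤ → Letter AB → ℤ → ℤ
isom j (pos a) y = - y + (j + j)
isom j (neg a) y = - y + (j + j)
isom j (pos b) y = y + + 1
isom j (neg b) y = y + - + 1

ρ : ℤ → F₂ → ℤ → ℤ
ρ j []      y = y
ρ j (ℓ ∷ w) y = isom j ℓ (ρ j w y)

ρ-++ : ∀ j u v y → ρ j (u ++ v) y ≡ ρ j u (ρ j v y)
ρ-++ j []      v y = refl
ρ-++ j (ℓ ∷ u) v y = cong (isom j ℓ) (ρ-++ j u v y)

isom-inverse : ∀ j ℓ y → isom j ℓ (isom j (invL ℓ) y) ≡ y
isom-inverse j (pos a) y = reflect j y
  where
  reflect : ∀ j y → - (- y + (j + j)) + (j + j) ≡ y
  reflect = solve-∀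
isom-inverse j (neg a) y = reflect j y
  where
  reflect : ∀ j y → - (- y + (j + j)) + (j + j) ≡ y
  reflect = solve-∀
isom-inverse j (pos b) y = translate y
  where
  translate : ∀ y → (y + - + 1) + + 1 ≡ y
  translate = solve-∀
isom-inverse j (neg b) y = translate y
  where
  translate : ∀ y → (y + + 1) + - + 1 ≡ y
  translate = solve-∀

ρ-cong : ∀ j {u v} → u ≈F v → ∀ y → ρ j u y ≡ ρ j v y
ρ-cong j ≈refl         y = refl
ρ-cong j (≈sym d)      y = sym (ρ-cong j d y)
ρ-cong j (≈trans d e)  y = trans (ρ-cong j d y) (ρ-cong j e y)
ρ-cong j (≈free u v ℓ) y =
  trans (ρ-++ j u (ℓ ∷ invL ℓ ∷ v) y)
    (trans (cong (ρ j u) (isom-inverse j ℓ (ρ j v y))) (sym (ρ-++ j u v y)))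
ρ-cong j (≈rel u v r ()) y

ρ-act : ∀ g j j′ → (∀ ℓ y → ρ j (act g [ ℓ ]) y ≡ isom j′ ℓ y) →
        ∀ w y → ρ j (act g w) y ≡ ρ j′ w y
ρ-act g j j′ h []      y = cong (λ z → ρ j z y) (act-[] g)
ρ-act g j j′ h (ℓ ∷ w) y = begin
  ρ j (act g (ℓ ∷ w)) y                  ≡⟨ cong (λ z → ρ j z y) (act-hom g [ ℓ ] w) ⟩
  ρ j (act g [ ℓ ] ++ act g w) y         ≡⟨ ρ-++ j (act g [ ℓ ]) (act g w) y ⟩
  ρ j (act g [ ℓ ]) (ρ j (act g w) y)    ≡⟨ h ℓ _ ⟩
  isom j′ ℓ (ρ j (act g w) y)            ≡⟨ cong (isom j′ ℓ) (ρ-act g j j′ h w y) ⟩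
  ρ j′ (ℓ ∷ w) y                         ∎
  where open ≡-Reasoning

Z-image : Letter AB → F₂
Z-image (pos a) = pos b ∷ neg a ∷ neg b ∷ []
Z-image (neg a) = pos b ∷ pos a ∷ neg b ∷ []
Z-image (pos b) = pos b ∷ pos a ∷ neg b ∷ neg a ∷ neg b ∷ []
Z-image (neg b) = pos b ∷ pos a ∷ pos b ∷ neg a ∷ neg b ∷ []

Z-on-letters : ∀ ℓ → act Z [ ℓ ] ≈F Z-image ℓ
Z-on-letters ℓ = by-reduction (act Z [ ℓ ]) (Z-image ℓ) (everyLetter same refl refl refl refl ℓ)
  where
  same : Letter AB → Set
  same ℓ = reduce (act Z [ ℓ ]) ≡ reduce (Z-image ℓ)

ρ-Z : ∀ j w y → ρ j (act Z w) y ≡ ρ (ℤ.suc j) w y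
ρ-Z j = ρ-act Z j (ℤ.suc j) (λ ℓ y → trans (ρ-cong j (Z-on-letters ℓ) y) (shift ℓ y))
  where
  shift : ∀ ℓ y → ρ j (Z-image ℓ) y ≡ isom (ℤ.suc j) ℓ y
  shift (pos a) y = conj-reflection j y
    where
    conj-reflection : ∀ j y → (- (y + - + 1) + (j + j)) + + 1 ≡ - y + ((+ 1 + j) + (+ 1 + j))
    conj-reflection = solve-∀
  shift (neg a) y = conj-reflection j y
    where
    conj-reflection : ∀ j y → (- (y + - + 1) + (j + j)) + + 1 ≡ - y + ((+ 1 + j) + (+ 1 + j))
    conj-reflection = solve-∀
  shift (pos b) y = conj-translation j y
    where
    conj-translation : ∀ j y → (- ((- (y + - + 1) + (j + j)) + - + 1) + (j + j)) + + 1 ≡ y + + 1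
    conj-translation = solve-∀
  shift (neg b) y = conj-translation j y
    where
    conj-translation : ∀ j y → (- ((- (y + - + 1) + (j + j)) + + 1) + (j + j)) + + 1 ≡ y + - + 1
    conj-translation = solve-∀

ρ-Z⁻¹ : ∀ j w y → ρ j (act Z⁻¹ w) y ≡ ρ (ℤ.pred j) w y
ρ-Z⁻¹ j w y = begin
  ρ j (act Z⁻¹ w) y                  ≡⟨ cong (λ i → ρ i (act Z⁻¹ w) y) (suc-pred j) ⟨
  ρ (ℤ.suc j′) (act Z⁻¹ w) y         ≡⟨ ρ-Z j′ (act Z⁻¹ w) y ⟨
  ρ j′ (act Z (act Z⁻¹ w)) y         ≡⟨ cong (λ z → ρ j′ z y) (act-++ Z Z⁻¹ w) ⟨
  ρ j′ (act (Z ++ Z⁻¹) w) y          ≡⟨ ρ-cong j′ (act-respects-B₃ (inverseʳ₀ Z) w) y ⟩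
  ρ j′ w y                           ∎
  where
  open ≡-Reasoning
  j′ = ℤ.pred j

ρ-pow : ∀ A δ → (∀ j w y → ρ j (act A w) y ≡ ρ (δ + j) w y) →
        ∀ n j w y → ρ j (act (powW A (+ n)) w) y ≡ ρ (j + + n * δ) w y
ρ-pow A δ h zero      j w y = cong (λ i → ρ i w y) (no-shift j δ)
  where
  no-shift : ∀ j δ → j ≡ j + + 0 * δ
  no-shift = solve-∀
ρ-pow A δ h (ℕ.suc n) j w y = begin
  ρ j (act (A ++ powW A (+ n)) w) y      ≡⟨ cong (λ z → ρ j z y) (act-++ A (powW A (+ n)) w) ⟩
  ρ j (act A (act (powW A (+ n)) w)) y   ≡⟨ h j _ y ⟩
  ρ (δ + j) (act (powW A (+ n)) w) y     ≡⟨ ρ-pow A δ h n (δ + j) w y ⟩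
  ρ ((δ + j) + + n * δ) w y              ≡⟨ cong (λ i → ρ i w y) (one-more δ j (+ n)) ⟩
  ρ (j + (+ 1 + + n) * δ) w y            ∎
  where
  open ≡-Reasoning
  one-more : ∀ δ j k → (δ + j) + k * δ ≡ j + (+ 1 + k) * δ
  one-more = solve-∀

ρ-Z^ : ∀ m j w y → ρ j (act (Z^ m) w) y ≡ ρ (j + m) w y
ρ-Z^ (+ n) j w y =
  trans (ρ-pow Z (+ 1) ρ-Z n j w y) (cong (λ i → ρ (j + i) w y) (times-one (+ n)))
  where
  times-one : ∀ i → i * + 1 ≡ i
  times-one = solve-∀
ρ-Z^ -[1+ n ] j w y =
  trans (ρ-pow Z⁻¹ (- + 1) ρ-Z⁻¹ (ℕ.suc n) j w y)
        (cong (λ i → ρ (j + i) w y) (times-minus-one (+ ℕ.suc n)))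
  where
  times-minus-one : ∀ i → i * - + 1 ≡ - i
  times-minus-one = solve-∀

reflection-fixing-0 : ∀ j → isom j (pos a) (+ 0) ≡ + 0 → j ≡ + 0
reflection-fixing-0 (+ zero)      eq = refl
reflection-fixing-0 (+ ℕ.suc n)   ()
reflection-fixing-0 -[1+ n ]      ()

Z^-fixing-a : ∀ m → act (Z^ m) aW ≈F aW → m ≡ + 0
Z^-fixing-a m fix = trans (sym (+-identityˡ m)) (reflection-fixing-0 (+ 0 + m) centre)
  where
  centre : ρ (+ 0 + m) aW (+ 0) ≡ + 0
  centre = trans (sym (ρ-Z^ m (+ 0) aW (+ 0))) (ρ-cong (+ 0) fix (+ 0))

H-stabiliser : ∀ e → act ⟦ e ⟧H aW ≈F aW → ∃ λ k → ⟦ e ⟧H ≈B σ₁^ k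
H-stabiliser e fix =
  k , ≈trans (exponents-sound e) (subst (λ i → ⟦ i , k ⟧Zσ ≈B σ₁^ k) (sym m≡0) ≈refl)
  where
  m = proj₁ (exponents e)
  k = proj₂ (exponents e)
  Z^m-fixes : act (Z^ m) aW ≈F aW
  Z^m-fixes = begin
    act (Z^ m) aW                 ≈⟨ act-cong (Z^ m) (σ₁^-fixes-a k) ⟨
    act (Z^ m) (act (σ₁^ k) aW)   ≡⟨ act-++ (Z^ m) (σ₁^ k) aW ⟨
    act ⟦ m , k ⟧Zσ aW            ≈⟨ act-respects-B₃ (exponents-sound e) aW ⟨
    act ⟦ e ⟧H aW                 ≈⟨ fix ⟩
    aW                            ∎
    where open ≈-Reasoning []
  m≡0 : m ≡ + 0
  m≡0 = Z^-fixing-a m Z^m-fixes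

normal-form-stabiliser : ∀ nf → act ⟦ nf ⟧N aW ≈F aW → ∃ λ k → ⟦ nf ⟧N ≈B σ₁^ k
normal-form-stabiliser (r , e) fix with representative-trivial r e fix
... | refl = H-stabiliser e fix

stabiliser-of-a : ∀ g → act g aW ≈F aW → ∃ λ k → g ≈B σ₁^ k
stabiliser-of-a g fix = k , ≈trans (normalise-sound g) nf≈
  where
  nf-fixes : act ⟦ normalise g ⟧N aW ≈F aW
  nf-fixes = ≈trans (≈sym (act-respects-B₃ (normalise-sound g) aW)) fix
  k = proj₁ (normal-form-stabiliser (normalise g) nf-fixes)
  nf≈ = proj₂ (normal-form-stabiliser (normalise g) nf-fixes)

-- Conjugating by σ₂ carries the stabiliser of ab to that of a
-- (σ₂⁻¹ acts by R_b, which sends a to ab), and σ₂⁻¹σ₁σ₂ = n⁻¹ for the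
-- generator n = σ₁σ₂⁻¹σ₁⁻¹ of N.
conj-fixes-a : ∀ g → act g abW ≈F abW → act (s₂ ∷ g ++ [ s₂⁻¹ ]) aW ≈F aW
conj-fixes-a g fix =
  ≈trans (≡⇒≈ (cong (substW (imgσ s₂)) (act-++ g [ s₂⁻¹ ] aW)))
    (≈trans (substW-cong (imgσ s₂) fix) (by-reduction _ _ refl))

n⁻¹≈ : invW nGen ≈B (s₂⁻¹ ∷ s₁ ∷ s₂ ∷ [])
n⁻¹≈ = ≈sym (begin
  s₂⁻¹ ∷ s₁ ∷ s₂ ∷ []                 ≈⟨ ≈free (s₂⁻¹ ∷ s₁ ∷ s₂ ∷ []) [] s₁ ⟨
  s₂⁻¹ ∷ s₁ ∷ s₂ ∷ s₁ ∷ s₁⁻¹ ∷ []     ≈⟨ ∙-congˡ [ s₂⁻¹ ] (braid [ s₁⁻¹ ]) ⟩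
  s₂⁻¹ ∷ s₂ ∷ s₁ ∷ s₂ ∷ s₁⁻¹ ∷ []     ≈⟨ cancel′ s₂ _ ⟩
  s₁ ∷ s₂ ∷ s₁⁻¹ ∷ []                 ∎)
  where open ≈-Reasoning (braidRelator ∷ [])

n≈ : nGen ≈B (s₂⁻¹ ∷ s₁⁻¹ ∷ s₂ ∷ [])
n≈ = ≈sym (begin
  s₂⁻¹ ∷ s₁⁻¹ ∷ s₂ ∷ []
    ≈⟨ ∙-congˡ (s₂⁻¹ ∷ s₁⁻¹ ∷ s₂ ∷ []) (inverseʳ₀ Y) ⟨
  s₂⁻¹ ∷ s₁⁻¹ ∷ s₂ ∷ s₁ ∷ s₂ ∷ s₂⁻¹ ∷ s₁⁻¹ ∷ []
    ≈⟨ ∙-congˡ (s₂⁻¹ ∷ s₁⁻¹ ∷ []) (braid _) ⟨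
  s₂⁻¹ ∷ s₁⁻¹ ∷ s₁ ∷ s₂ ∷ s₁ ∷ s₂⁻¹ ∷ s₁⁻¹ ∷ []
    ≈⟨ ∙-congˡ [ s₂⁻¹ ] (cancel′ s₁ _) ⟩
  s₂⁻¹ ∷ s₂ ∷ s₁ ∷ s₂⁻¹ ∷ s₁⁻¹ ∷ []
    ≈⟨ cancel′ s₂ _ ⟩
  s₁ ∷ s₂⁻¹ ∷ s₁⁻¹ ∷ []
    ∎)
  where open ≈-Reasoning (braidRelator ∷ [])

conj-σ₁^ : ∀ k → (s₂⁻¹ ∷ σ₁^ k ++ [ s₂ ]) ≈B powW nGen (- k)
conj-σ₁^ (+ zero)    = cancel′ s₂ []
conj-σ₁^ (+ ℕ.suc n) = ≈sym (≈trans (pow-cong n⁻¹≈ (ℕ.suc n)) (conj-pow s₂ [ s₁ ] (ℕ.suc n)))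
conj-σ₁^ -[1+ n ]    = ≈sym (≈trans (pow-cong n≈ (ℕ.suc n)) (conj-pow s₂ [ s₁⁻¹ ] (ℕ.suc n)))

N-fixes-ab : ∀ k → act (powW nGen k) abW ≈F abW
N-fixes-ab = pow-fixesℤ nGen abW (by-reduction _ _ refl) (by-reduction _ _ refl)

stabiliser-of-ab : ∀ g → act g abW ≈F abW → InN g
stabiliser-of-ab g fix = - k , (begin
  g                                        ≈⟨ unconjugate s₂ g ⟩
  s₂⁻¹ ∷ (s₂ ∷ g ++ [ s₂⁻¹ ]) ++ [ s₂ ]    ≈⟨ ∙-congˡ [ s₂⁻¹ ] (∙-congʳ [ s₂ ] g′≈) ⟩
  s₂⁻¹ ∷ σ₁^ k ++ [ s₂ ]                   ≈⟨ conj-σ₁^ k ⟩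
  powW nGen (- k)                          ∎)
  where
  open ≈-Reasoning (braidRelator ∷ [])
  stab = stabiliser-of-a (s₂ ∷ g ++ [ s₂⁻¹ ]) (conj-fixes-a g fix)
  k    = proj₁ stab
  g′≈  = proj₂ stab

Pal-trivial⇔ : ∀ w → (Pal w ≈F []) ⇔ (act (β w) abW ≈F abW)
Pal-trivial⇔ w =
  subst (λ u → (Pal w ≈F []) ⇔ (u ≈F abW)) (R-is-act-β w abW) (inverse-solve abW (R w abW))

proposition5p2 : ∀ (w : F₂) → (Pal w ≈F []) ⇔ InN (β w)
proposition5p2 w = mk⇔
  (λ pal → stabiliser-of-ab (β w) (Equivalence.to (Pal-trivial⇔ w) pal))
  (λ { (k , β≈nᵏ) → Equivalence.from (Pal-trivial⇔ w)
                       (≈trans (act-respects-B₃ β≈nᵏ abW) (N-fixes-ab k)) })
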